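{- Let $(\vec G=(V,E),\sigma)$ be a properly vertex-colored digraph with $|V|\ge 2$. Then $U^*(\vec G)=\{(x,y)\mid (x,y)\notin E,\ x\ne y,\ V[\sigma(y)]=\{y\}\}$.
   Context: A digraph $\vec G=(V,E)$ has a finite vertex set and arc set $E\subseteq (V\times V)\setminus\{(v,v)\mid v\in V\}$; a vertex coloring $\sigma$ is proper if adjacent vertices have distinct colors; $V[r]$ is the set of vertices of color $r$. All rooted trees are phylogenetic (every non-leaf vertex has at least two children); $L(T)$ is the leaf set; $u\preceq_T v$ means $v$ lies on the path from $u$ to the root; $\mathrm{lca}_T$ is the last common ancestor. For a tree $T$ with leaf coloring $\sigma$, a leaf $y$ is a best match of a leaf $x$ if $\sigma(x)\ne\sigma(y)$ and $\mathrm{lca}_T(x,y)\preceq_T\mathrm{lca}_T(x,y')$ for all leaves $y'$ with $\sigma(y')=\sigma(y)$; the best match graph $\vec G(T,\sigma)$ has vertex set $L(T)$ and arcs $(x,y)$ whenever $y$ is a best match of $x$. For a tree $T$ with $L(T)=V$, $U(\vec G,T)=E\triangle E(\vec G(T,\sigma))$ (as sets of ordered pairs). Let $\mathscr T_V$ be the set of all phylogenetic trees with leaf set $V$, and $U^*(\vec G)=\bigcap_{T\in\mathscr T_V}U(\vec G,T)$. -}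

module Defs where

open import Data.Nat using (ℕ; zero; suc; _≤_)
open import Data.Fin using (Fin)
open import Data.Fin.Base using ()
open import Data.List using (List; []; _∷_; length; _++_; allFin)
open import Data.List.Relation.Unary.All using (All)
open import Data.List.Relation.Binary.Permutation.Propositional using (_↭_)
open import Data.Product using (_×_; Σ)
open import Data.Sum using (_⊎_)
open import Relation.Nullary using (¬_; yes; no)
open import Relation.Binary.PropositionalEquality using (_≡_; _≢_)
import Data.Nat as N

-- Rooted trees whose leaves are labelled by elements of V = Fin n.
-- A vertex of a tree is addressed by its path from the root: a list of
-- child indices.  The root is the empty path.

data Tree (n : ℕ) : Set where
  leaf : Fin n → Tree n
  node : List (Tree n) → Tree n

mutual
  leaves : ∀ {n} → Tree n → List (Fin n)
  leaves (leaf x)  = x ∷ []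
  leaves (node ts) = leavesL ts

  leavesL : ∀ {n} → List (Tree n) → List (Fin n)
  leavesL []       = []
  leavesL (t ∷ ts) = leaves t ++ leavesL ts

data Phylo {n : ℕ} : Tree n → Set where
  leafP : ∀ x → Phylo (leaf x)
  nodeP : ∀ {ts} → 2 ≤ length ts → All Phylo ts → Phylo (node ts)

-- T is a phylogenetic tree with leaf set exactly V = Fin n
-- (every element of V labels exactly one leaf)
IsPhyloTreeOn : (n : ℕ) → Tree n → Set
IsPhyloTreeOn n T = Phylo T × (leaves T ↭ allFin n)

Path : Set
Path = List ℕ

data ChildAt {n : ℕ} : List (Tree n) → ℕ → Tree n → Set where
  here  : ∀ {t ts} → ChildAt (t ∷ ts) zero t
  there : ∀ {s ts i t} → ChildAt ts i t → ChildAt (s ∷ ts) (suc i) t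

data LeafAt {n : ℕ} : Tree n → Path → Fin n → Set where
  atLeaf : ∀ x → LeafAt (leaf x) [] x
  down   : ∀ {ts i t p x} → ChildAt ts i t → LeafAt t p x → LeafAt (node ts) (i ∷ p) x

data Prefix : Path → Path → Set where
  []  : ∀ {q} → Prefix [] q
  _∷_ : ∀ a {p q} → Prefix p q → Prefix (a ∷ p) (a ∷ q)

-- ancestor order: u ⪯ v  iff  v lies on the path from u to the root
_⪯_ : Path → Path → Set
u ⪯ v = Prefix v u

-- last common ancestor of two vertices = longest common prefix
lca : Path → Path → Path
lca []       _        = []
lca (_ ∷ _)  []       = []
lca (a ∷ p)  (b ∷ q) with a N.≟ b
... | yes _ = a ∷ lca p q
... | no  _ = []

BestMatch : ∀ {n} → Tree n → (Fin n → ℕ) → Fin n → Fin n → Set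
BestMatch {n} T σ x y =
  σ x ≢ σ y ×
  ((y' : Fin n) → σ y' ≡ σ y →
     ∀ {px py py'} → LeafAt T px x → LeafAt T py y → LeafAt T py' y' →
     lca px py ⪯ lca px py')

-- (x , y) ∈ U(G, T) = E △ E(G(T, σ))
InU : ∀ {n} → (Fin n → Fin n → Set) → Tree n → (Fin n → ℕ) → Fin n → Fin n → Set
InU E T σ x y = (E x y × ¬ BestMatch T σ x y) ⊎ (¬ E x y × BestMatch T σ x y)

-- (x , y) ∈ U*(G) = ⋂ over all phylogenetic trees T on V of U(G, T)
InUStar : ∀ {n} → (Fin n → Fin n → Set) → (Fin n → ℕ) → Fin n → Fin n → Set
InUStar {n} E σ x y = (T : Tree n) → IsPhyloTreeOn n T → InU E T σ x y

IsDigraph : ∀ {n} → (Fin n → Fin n → Set) → Set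
IsDigraph {n} E = (v : Fin n) → ¬ E v v

IsProper : ∀ {n} → (Fin n → Fin n → Set) → (Fin n → ℕ) → Set
IsProper {n} E σ = (x y : Fin n) → E x y → σ x ≢ σ y

-- If y is the only vertex of its colour, then y is a best match of every
-- other vertex x in every tree, so (x , y) lies in U(G, T) for all T exactly
-- when (x , y) ∉ E.  Conversely, in the star tree every differently coloured
-- pair is a best match, which forces (x , y) ∉ E (E is properly coloured)
-- and hence (x , y) must be a best match in every tree; and if some z ≠ y
-- had the colour of y, the tree ((x , z) , rest) would make z, not y, the
-- best match of x.
module Submission where

open import Defs
open import Data.Nat using (ℕ; _≤_; zero; suc; s≤s; z≤n)
import Data.Nat as ℕ
open import Data.Fin using (Fin; _≟_)
open import Data.Product using (_×_; _,_; ∃-syntax)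
open import Data.Sum using (inj₁; inj₂)
open import Data.Empty using (⊥-elim)
open import Function.Bundles using (_⇔_; mk⇔)
open import Relation.Nullary using (¬_; yes; no)
open import Relation.Binary.PropositionalEquality
  using (_≡_; _≢_; refl; sym; trans; cong; subst; setoid)
open import Data.List using (List; []; _∷_; length; _++_; allFin; map)
open import Data.List.Properties using (length-map; length-tabulate)
open import Data.List.Relation.Unary.All as All using (All; []; _∷_)
import Data.List.Relation.Unary.All.Properties as All
open import Data.List.Relation.Unary.Any using (here; there)
open import Data.List.Membership.Propositional using (_∈_)
open import Data.List.Membership.Propositional.Properties
  using (∈-allFin; ∈-∃++; ∈-++⁺ˡ; ∈-++⁺ʳ)
open import Data.List.Relation.Binary.Disjoint.Propositional using (Disjoint)
open import Data.List.Relation.Unary.Unique.Propositional using (Unique)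
open import Data.List.Relation.Unary.AllPairs using ([]; _∷_)
open import Data.List.Relation.Unary.Unique.Propositional.Properties using (allFin⁺)
open import Data.List.Relation.Binary.Permutation.Propositional
  using (_↭_; ↭-sym; ↭-trans; ↭-prep; ↭-reflexive; ↭⇒↭ₛ)
open import Data.List.Relation.Binary.Permutation.Propositional.Properties
  using (shift; ∈-resp-↭)
import Data.List.Relation.Binary.Permutation.Setoid.Properties as Perm

private
  variable
    n : ℕ
    x y z v w : Fin n
    xs ys rest : List (Fin n)
    p q : Path
    i j : ℕ
    E : Fin n → Fin n → Set
    t t′ : Tree n
    ts : List (Tree n)
    σ : Fin n → ℕ

Unique-++⁻ : (xs : List (Fin n)) → Unique (xs ++ ys) →
  Unique xs × Unique ys × Disjoint xs ys
Unique-++⁻ []       u        = [] , u , λ ()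
Unique-++⁻ (x ∷ xs) (x∉ ∷ u) with Unique-++⁻ xs u
... | uxs , uys , xs#ys = All.++⁻ˡ xs x∉ ∷ uxs , uys , disjoint
  where
  disjoint : Disjoint (x ∷ xs) _
  disjoint (here refl  , v∈ys) = All.lookup x∉ (∈-++⁺ʳ xs v∈ys) refl
  disjoint (there v∈xs  , v∈ys) = xs#ys (v∈xs , v∈ys)

∈⇒↭∷ : v ∈ xs → ∃[ ys ] xs ↭ v ∷ ys
∈⇒↭∷ {v = v} v∈xs with as , bs , refl ← ∈-∃++ v∈xs = as ++ bs , shift v as bs

∈-↭∷ : xs ↭ v ∷ ys → w ∈ xs → w ≢ v → w ∈ ys
∈-↭∷ xs↭ w∈xs w≢v with ∈-resp-↭ xs↭ w∈xs
... | here w≡v    = ⊥-elim (w≢v w≡v)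
... | there w∈ys  = w∈ys

Prefix-refl : (p : Path) → Prefix p p
Prefix-refl []      = []
Prefix-refl (a ∷ p) = a ∷ Prefix-refl p

IsPhyloTreeOn⇒Unique-leaves : IsPhyloTreeOn n t → Unique (leaves t)
IsPhyloTreeOn⇒Unique-leaves {n} (_ , leaves↭) =
  Perm.Unique-resp-↭ (setoid (Fin _)) (↭⇒↭ₛ (↭-sym leaves↭)) (allFin⁺ n)

ChildAt-functional : ChildAt ts i t → ChildAt ts i t′ → t ≡ t′
ChildAt-functional here      here       = refl
ChildAt-functional (there c) (there c′) = ChildAt-functional c c′

LeafAt-functional : LeafAt t p x → LeafAt t p y → x ≡ y
LeafAt-functional (atLeaf x) (atLeaf .x) = refl
LeafAt-functional (down c l) (down c′ l′) with ChildAt-functional c c′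
... | refl = LeafAt-functional l l′

mutual
  LeafAt⇒∈ : LeafAt t p x → x ∈ leaves t
  LeafAt⇒∈ (atLeaf x) = here refl
  LeafAt⇒∈ (down c l) = ChildAt⇒∈ c l

  ChildAt⇒∈ : ChildAt ts i t → LeafAt t p x → x ∈ leavesL ts
  ChildAt⇒∈ here      l = ∈-++⁺ˡ (LeafAt⇒∈ l)
  ChildAt⇒∈ (there {s = s} c) l = ∈-++⁺ʳ (leaves s) (ChildAt⇒∈ c l)

mutual
  LeafAt-injective : Unique (leaves t) → LeafAt t p x → LeafAt t q x → p ≡ q
  LeafAt-injective u (atLeaf x) (atLeaf .x) = refl
  LeafAt-injective u (down c l) (down c′ l′) = ChildAt-injective u c l c′ l′

  ChildAt-injective : Unique (leavesL ts) →
    ChildAt ts i t → LeafAt t p x → ChildAt ts j t′ → LeafAt t′ q x → i ∷ p ≡ j ∷ q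
  ChildAt-injective {ts = s ∷ _} u c l c′ l′ with Unique-++⁻ (leaves s) u
  ChildAt-injective u here l here l′ | us , _ , _ =
    cong (zero ∷_) (LeafAt-injective us l l′)
  ChildAt-injective u here l (there c′) l′ | _ , _ , s#ss =
    ⊥-elim (s#ss (LeafAt⇒∈ l , ChildAt⇒∈ c′ l′))
  ChildAt-injective u (there c) l here l′ | _ , _ , s#ss =
    ⊥-elim (s#ss (LeafAt⇒∈ l′ , ChildAt⇒∈ c l))
  ChildAt-injective u (there c) l (there c′) l′ | _ , uss , _
    with ChildAt-injective uss c l c′ l′
  ... | refl = refl

uniqueColour⇒BestMatch : Unique (leaves t) → x ≢ y →
  (∀ z → σ z ≡ σ y → z ≡ y) → BestMatch t σ x y
uniqueColour⇒BestMatch {t = t} {x = x} {y = y} {σ = σ} u x≢y unique =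
  (λ σx≡σy → x≢y (unique x σx≡σy)) , onlyCandidate
  where
  onlyCandidate : ∀ y′ → σ y′ ≡ σ y → ∀ {px py py′} →
    LeafAt t px x → LeafAt t py y → LeafAt t py′ y′ → lca px py ⪯ lca px py′
  onlyCandidate y′ σy′≡σy {px} lx ly ly′ with unique y′ σy′≡σy
  ... | refl with LeafAt-injective u ly ly′
  ... | refl = Prefix-refl (lca px _)

leavesL-map-leaf : (xs : List (Fin n)) → leavesL (map leaf xs) ≡ xs
leavesL-map-leaf []       = refl
leavesL-map-leaf (x ∷ xs) = cong (x ∷_) (leavesL-map-leaf xs)

All-Phylo-map-leaf : (xs : List (Fin n)) → All Phylo (map leaf xs)
All-Phylo-map-leaf xs = All.map⁺ (All.universal leafP xs)

∈⇒ChildAt-map-leaf : v ∈ xs → ∃[ i ] ChildAt (map leaf xs) i (leaf v)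
∈⇒ChildAt-map-leaf (here refl) = zero , here
∈⇒ChildAt-map-leaf (there v∈xs) with i , c ← ∈⇒ChildAt-map-leaf v∈xs = suc i , there c

ChildAt-map-leaf : ChildAt (map leaf xs) i t → ∃[ v ] t ≡ leaf v
ChildAt-map-leaf {xs = v ∷ _} here      = v , refl
ChildAt-map-leaf {xs = _ ∷ _} (there c) = ChildAt-map-leaf c

star : (n : ℕ) → Tree n
star n = node (map leaf (allFin n))

star-IsPhyloTreeOn : 2 ≤ n → IsPhyloTreeOn n (star n)
star-IsPhyloTreeOn {n} 2≤n =
  nodeP (subst (2 ≤_) (sym length-star) 2≤n) (All-Phylo-map-leaf (allFin n)) ,
  ↭-reflexive (leavesL-map-leaf (allFin n))
  where
  length-star : length (map leaf (allFin n)) ≡ n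
  length-star = trans (length-map leaf (allFin n)) (length-tabulate _)

LeafAt-star : LeafAt (star n) p x → ∃[ i ] p ≡ i ∷ []
LeafAt-star (down {i = i} c l) with ChildAt-map-leaf c
LeafAt-star (down {i = i} c (atLeaf _)) | _ , refl = i , refl

lca-star : x ≢ y → LeafAt (star n) p x → LeafAt (star n) q y → lca p q ≡ []
lca-star x≢y lx ly with LeafAt-star lx | LeafAt-star ly
... | i , refl | j , refl with i ℕ.≟ j
...   | yes refl = ⊥-elim (x≢y (LeafAt-functional lx ly))
...   | no _     = refl

star-BestMatch : σ x ≢ σ y → BestMatch (star n) σ x y
star-BestMatch {σ = σ} σx≢σy = σx≢σy , λ y′ σy′≡σy {px} {py} lx ly ly′ →
  let x≢y′ = λ x≡y′ → σx≢σy (trans (cong σ x≡y′) σy′≡σy)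
  in  subst (λ r → lca px py ⪯ r) (sym (lca-star x≢y′ lx ly′)) []

cherry : Fin n → Fin n → List (Fin n) → Tree n
cherry x z rest = node (node (leaf x ∷ leaf z ∷ []) ∷ map leaf rest)

-- In the cherry, x and z meet strictly below the root, where x meets y.
cherry-¬BestMatch : σ z ≡ σ y → y ∈ rest → ¬ BestMatch (cherry x z rest) σ x y
cherry-¬BestMatch {z = z} {y = y} {x = x} σz≡σy y∈rest (_ , closest)
  with i , c ← ∈⇒ChildAt-map-leaf y∈rest
  with closest z σz≡σy
         (down here (down here (atLeaf x)))
         (down (there c) (atLeaf y))
         (down here (down (there here) (atLeaf z)))
... | ()

cherry-IsPhyloTreeOn : v ∈ rest → x ∷ z ∷ rest ↭ allFin n →
  IsPhyloTreeOn n (cherry x z rest)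
cherry-IsPhyloTreeOn {rest = r ∷ rs} {x = x} {z = z} _ ↭allFin =
  nodeP (s≤s (s≤s z≤n)) (nodeP (s≤s (s≤s z≤n)) (leafP x ∷ leafP z ∷ [])
                         ∷ All-Phylo-map-leaf (r ∷ rs)) ,
  ↭-trans (↭-reflexive (cong (λ l → x ∷ z ∷ l) (leavesL-map-leaf (r ∷ rs)))) ↭allFin

∃cherry-IsPhyloTreeOn : x ≢ z → y ≢ x → y ≢ z →
  ∃[ rest ] y ∈ rest × IsPhyloTreeOn n (cherry x z rest)
∃cherry-IsPhyloTreeOn {x = x} {z = z} {y = y} x≢z y≢x y≢z
  with ys , allFin↭x∷ys ← ∈⇒↭∷ (∈-allFin x)
  with rest , ys↭z∷rest ←
         ∈⇒↭∷ (∈-↭∷ allFin↭x∷ys (∈-allFin z) (λ z≡x → x≢z (sym z≡x)))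
  = rest , y∈rest , cherry-IsPhyloTreeOn y∈rest
      (↭-sym (↭-trans allFin↭x∷ys (↭-prep x ys↭z∷rest)))
  where
  y∈rest : y ∈ rest
  y∈rest = ∈-↭∷ ys↭z∷rest (∈-↭∷ allFin↭x∷ys (∈-allFin y) y≢x) y≢z

InU-¬E⇒BestMatch : ¬ E x y → InU E t σ x y → BestMatch t σ x y
InU-¬E⇒BestMatch ¬e (inj₁ (e , _)) = ⊥-elim (¬e e)
InU-¬E⇒BestMatch ¬e (inj₂ (_ , bm)) = bm

InUStar⇒¬E : 2 ≤ n → IsProper {n} E σ → InUStar E σ x y → ¬ E x y
InUStar⇒¬E {x = x} {y = y} 2≤n proper h e with h (star _) (star-IsPhyloTreeOn 2≤n)
... | inj₁ (_ , ¬bm) = ¬bm (star-BestMatch (proper x y e))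
... | inj₂ (¬e , _)  = ¬e e

BestMatch-everywhere⇒uniqueColour : 2 ≤ n →
  (∀ t → IsPhyloTreeOn n t → BestMatch t σ x y) →
  x ≢ y × (∀ z → σ z ≡ σ y → z ≡ y)
BestMatch-everywhere⇒uniqueColour {n} {σ} {x} {y} 2≤n bm = x≢y , unique
  where
  σx≢σy : σ x ≢ σ y
  σx≢σy with σx≢σy , _ ← bm (star n) (star-IsPhyloTreeOn 2≤n) = σx≢σy

  x≢y : x ≢ y
  x≢y x≡y = σx≢σy (cong σ x≡y)

  x≢z : ∀ {z} → σ z ≡ σ y → x ≢ z
  x≢z σz≡σy x≡z = σx≢σy (trans (cong σ x≡z) σz≡σy)

  unique : ∀ z → σ z ≡ σ y → z ≡ y
  unique z σz≡σy with z ≟ y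
  ... | yes z≡y = z≡y
  ... | no  z≢y
    with rest , y∈rest , cherry-on ←
           ∃cherry-IsPhyloTreeOn (x≢z σz≡σy) (λ y≡x → x≢y (sym y≡x)) (λ y≡z → z≢y (sym y≡z))
    = ⊥-elim (cherry-¬BestMatch σz≡σy y∈rest (bm _ cherry-on))

theorem2 : (n : ℕ) → 2 ≤ n → (E : Fin n → Fin n → Set) → (σ : Fin n → ℕ) →
    IsDigraph E → IsProper E σ →
    (x y : Fin n) →
    InUStar E σ x y ⇔ ((¬ E x y) × (x ≢ y) × ((z : Fin n) → σ z ≡ σ y → z ≡ y))
theorem2 n 2≤n E σ _ proper x y = mk⇔ to from
  where
  to : InUStar E σ x y → ¬ E x y × x ≢ y × (∀ z → σ z ≡ σ y → z ≡ y)
  to h = ¬e , BestMatch-everywhere⇒uniqueColour 2≤n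
                (λ t t-on → InU-¬E⇒BestMatch {E = E} ¬e (h t t-on))
    where
    ¬e : ¬ E x y
    ¬e = InUStar⇒¬E 2≤n proper h

  from : ¬ E x y × x ≢ y × (∀ z → σ z ≡ σ y → z ≡ y) → InUStar E σ x y
  from (¬e , x≢y , unique) t t-on =
    inj₂ (¬e , uniqueColour⇒BestMatch (IsPhyloTreeOn⇒Unique-leaves t-on) x≢y unique)
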